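{- Let $\mu$ be a Lyndon word, let $s$ be a proper suffix of $\mu$ and $p$ a proper prefix of $\mu$ (each possibly empty), let $t\ge 2$, and let $\mathcal{S}=s\cdot\mu^t\cdot p$. Let $x_1,\dots,x_{k_1}$ be the Lyndon factorization of $s$ and $y_1,\dots,y_{k_2}$ the Lyndon factorization of $p$. Then the Lyndon factorization of $\mathcal{S}$ is $x_1,\dots,x_{k_1},\underbrace{\mu,\dots,\mu}_{t\text{ times}},y_1,\dots,y_{k_2}$.
   Context: A Lyndon word is a non-empty string strictly lexicographically smaller than each of its proper non-empty suffixes. The Lyndon factorization of a string $\mathcal{S}$ is the unique decomposition $\mathcal{S}=s_1\cdot s_2\cdots s_m$ into Lyndon words with $s_{i-1}\succeq s_i$ for all $i\in[2,m]$ (the empty string has the empty factorization). -}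

module Defs where

open import Level using (Level)
open import Data.List using (List; []; _∷_; _++_; concat)
open import Data.List.Relation.Unary.All using (All)
open import Data.List.Relation.Unary.Linked using (Linked)
open import Data.Product using (_×_; ∃; _,_)
open import Data.Sum using (_⊎_)
open import Relation.Binary.PropositionalEquality using (_≡_)
open import Relation.Binary.Core using (Rel)
open import Relation.Nullary using (¬_)

module Words {A : Set} (_<_ : Rel A Level.zero) where

  data _≺_ : List A → List A → Set where
    halt : ∀ {y ys} → [] ≺ (y ∷ ys)
    this : ∀ {x y xs ys} → x < y → (x ∷ xs) ≺ (y ∷ ys)
    next : ∀ {x xs ys} → xs ≺ ys → (x ∷ xs) ≺ (x ∷ ys)

  _⪰_ : List A → List A → Set
  u ⪰ v = (v ≺ u) ⊎ (u ≡ v)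

  NonEmpty : List A → Set
  NonEmpty w = ¬ (w ≡ [])

  ProperNonEmptySuffix : List A → List A → Set
  ProperNonEmptySuffix v w = NonEmpty v × ∃ λ u → NonEmpty u × (u ++ v ≡ w)

  Lyndon : List A → Set
  Lyndon w = NonEmpty w × (∀ v → ProperNonEmptySuffix v w → w ≺ v)

  ProperSuffix : List A → List A → Set
  ProperSuffix s w = ∃ λ u → NonEmpty u × (u ++ s ≡ w)

  ProperPrefix : List A → List A → Set
  ProperPrefix p w = ∃ λ u → NonEmpty u × (p ++ u ≡ w)

  -- fs is the Lyndon factorization of S: fs concatenates to S, each factor
  -- is Lyndon, and consecutive factors are non-increasing (s_{i-1} ⪰ s_i).
  -- (By uniqueness of the Lyndon factorization, this characterizes *the*
  -- factorization; the empty word has the empty factorization.)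
  IsLyndonFactorization : List (List A) → List A → Set
  IsLyndonFactorization fs S =
    (concat fs ≡ S) × All Lyndon fs × Linked _⪰_ fs

{-# OPTIONS --safe #-}
module Submission where

-- The factors coming from s all lie to the left of the run of μ's and
-- those coming from p to its right, so only the two junctions need checking.
-- The last factor x of s is a non-empty proper suffix of μ, so μ ≺ x because
-- μ is Lyndon; the first factor y of p is a proper prefix of μ, so y ≺ μ.

open import Defs
open import Level using (Level; 0ℓ)
open import Data.Nat using (ℕ; _≥_; zero; suc; s≤s)
open import Data.List using (List; []; _∷_; _++_; concat; replicate; head; last)
open import Data.List.Properties using (concat-++; ++-assoc; ++-identityʳ; ++-conicalˡ; ++-conicalʳ)
open import Data.List.Relation.Unary.All using (All; _∷_)
open import Data.List.Relation.Unary.All.Properties using (++⁺; replicate⁺)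
open import Data.List.Relation.Unary.Linked using (Linked; [-]; _∷_)
import Data.List.Relation.Unary.Linked.Properties as Linked
open import Data.Maybe using (just)
open import Data.Maybe.Relation.Binary.Connected using (Connected; just; just-nothing; nothing-just)
open import Data.Product using (_,_; proj₁; proj₂)
open import Data.Sum using (inj₁; inj₂)
open import Function using (_∘′_)
open import Relation.Binary.Core using (Rel)
open import Relation.Binary.Definitions using (Reflexive)
open import Relation.Binary.Structures using (IsStrictTotalOrder)
open import Relation.Nullary using (contradiction)
open import Relation.Binary.PropositionalEquality using (_≡_; refl; sym; trans; cong; subst)

module _ {a ℓ : Level} {A : Set a} {R : Rel A ℓ} (R-refl : Reflexive R) where

  Linked-replicate-++ : ∀ n {x ys} → Linked R (x ∷ ys) → Linked R (replicate (suc n) x ++ ys)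
  Linked-replicate-++ zero    x∷ys = x∷ys
  Linked-replicate-++ (suc n) x∷ys = R-refl ∷ Linked-replicate-++ n x∷ys

module _ {A : Set} (_<_ : Rel A 0ℓ) where
  open Words _<_

  ⪰-refl : Reflexive _⪰_
  ⪰-refl = inj₂ refl

  ≺-++ : ∀ y {z} → NonEmpty z → y ≺ (y ++ z)
  ≺-++ []      {[]}    z≢[] = contradiction refl z≢[]
  ≺-++ []      {_ ∷ _} _    = halt
  ≺-++ (_ ∷ y)         z≢[] = next (≺-++ y z≢[])

  last-suffixFactor-⪰ : ∀ {μ} → Lyndon μ → ∀ xs → All Lyndon xs → ProperSuffix (concat xs) μ →
                        Connected _⪰_ (last xs) (just μ)
  last-suffixFactor-⪰ lμ []               _         _                 = nothing-just
  last-suffixFactor-⪰ lμ (x ∷ [])         (lx ∷ _)  (u , u≢[] , u++x) =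
    just (inj₁ (proj₂ lμ x (proj₁ lx , u , u≢[] , trans (cong (u ++_) (sym (++-identityʳ x))) u++x)))
  last-suffixFactor-⪰ lμ (x ∷ xs@(_ ∷ _)) (_ ∷ lxs) (u , u≢[] , u++x++xs) =
    last-suffixFactor-⪰ lμ xs lxs
      (u ++ x , u≢[] ∘′ ++-conicalˡ u x , trans (++-assoc u x (concat xs)) u++x++xs)

  head-prefixFactor-≺ : ∀ {μ} ys → ProperPrefix (concat ys) μ → Connected _⪰_ (just μ) (head ys)
  head-prefixFactor-≺ []       _                    = just-nothing
  head-prefixFactor-≺ (y ∷ ys) (w , w≢[] , y++ys++w) =
    just (inj₁ (subst (y ≺_) (trans (sym (++-assoc y (concat ys) w)) y++ys++w)
                              (≺-++ y (λ ys++w≡[] → w≢[] (++-conicalʳ (concat ys) w ys++w≡[])))))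

mainTheorem11 : {A : Set} (_<_ : Rel A 0ℓ) → IsStrictTotalOrder _≡_ _<_ →
    let open Words _<_ in
    (μ s p : List A) (t : ℕ) (xs ys : List (List A)) →
    Lyndon μ → ProperSuffix s μ → ProperPrefix p μ → t ≥ 2 →
    IsLyndonFactorization xs s → IsLyndonFactorization ys p →
    IsLyndonFactorization (xs ++ replicate t μ ++ ys) (s ++ concat (replicate t μ) ++ p)
mainTheorem11 _<_ _ μ _ _ (suc n) xs ys lμ s-suffix p-prefix (s≤s _)
  (refl , lxs , xs-linked) (refl , lys , ys-linked) =
  concat-split , ++⁺ lxs (++⁺ (replicate⁺ (suc n) lμ) lys) , linked
  where
  open Words _<_
  concat-split : concat (xs ++ replicate (suc n) μ ++ ys)
               ≡ concat xs ++ concat (replicate (suc n) μ) ++ concat ys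
  concat-split = trans (sym (concat-++ xs (replicate (suc n) μ ++ ys))) (cong (concat xs ++_) (sym (concat-++ (replicate (suc n) μ) ys)))
  linked : Linked _⪰_ (xs ++ replicate (suc n) μ ++ ys)
  linked = Linked.++⁺ xs-linked (last-suffixFactor-⪰ _<_ lμ xs lxs s-suffix)
             (Linked-replicate-++ (⪰-refl _<_) n
               (Linked.++⁺ [-] (head-prefixFactor-≺ _<_ ys p-prefix) ys-linked))
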